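{- For every finite graph $G$ and every family of graphs $\mathcal{F}$, $|\iota_{\rm g}(G,\mathcal{F})-\iota_{\rm g}'(G,\mathcal{F})|\le 1$.
   Context: All graphs are finite and simple; $N[S]$ denotes the closed neighborhood of a vertex set $S$. A graph is $\mathcal{F}$-forbidden if it contains no member of $\mathcal{F}$ as a subgraph. In the $\mathcal{F}$-isolation game on $G$, Dominator and Staller alternately choose vertices of $G$; if $S$ is the set of already chosen vertices, a vertex $x$ may be chosen only if it dominates (equals or is adjacent to) some vertex $y$ lying in a component of $G-N[S]$ that is not $\mathcal{F}$-forbidden. The game ends when no such vertex exists. Dominator wants to minimize the number of chosen vertices, Staller wants to maximize it. $\iota_{\rm g}(G,\mathcal{F})$ is the number of chosen vertices under optimal play when Dominator moves first, and $\iota_{\rm g}'(G,\mathcal{F})$ the number when Staller moves first. -}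

module Defs where

open import Data.Nat using (ℕ; zero; suc; _≤_)
open import Data.Fin using (Fin)
open import Data.Bool using (Bool; true; false)
open import Data.List using (List; []; _∷_)
open import Data.List.Relation.Unary.Any using (Any)
open import Data.Product using (Σ; ∃; _×_)
open import Data.Sum using (_⊎_)
open import Data.Empty using (⊥)
open import Relation.Nullary using (¬_)
open import Relation.Binary.PropositionalEquality using (_≡_)
open import Function.Definitions using (Injective)

record Graph (n : ℕ) : Set where
  field
    E     : Fin n → Fin n → Bool
    sym   : ∀ u v → E u v ≡ E v u
    irrefl : ∀ v → E v v ≡ false
open Graph public

Adj : ∀ {n} → Graph n → Fin n → Fin n → Set
Adj G u v = E G u v ≡ true

Family : Set₁
Family = (m : ℕ) → Graph m → Set

Dominates : ∀ {n} → Graph n → Fin n → Fin n → Set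
Dominates G x y = x ≡ y ⊎ Adj G x y

InClosedNbhd : ∀ {n} → Graph n → List (Fin n) → Fin n → Set
InClosedNbhd G S v = Any (λ s → Dominates G s v) S

-- z lies in the component of y in G - N[S]
data InComp {n} (G : Graph n) (S : List (Fin n)) (y : Fin n) : Fin n → Set where
  here : ¬ InClosedNbhd G S y → InComp G S y y
  step : ∀ {z w} → InComp G S y z → Adj G z w → ¬ InClosedNbhd G S w → InComp G S y w

-- The component of G - N[S] containing y contains some member of F as a subgraph
-- (an injective adjacency-preserving map from the member into the component).
CompNotForbidden : ∀ {n} → Graph n → Family → List (Fin n) → Fin n → Set
CompNotForbidden {n} G F S y =
  Σ ℕ λ m → Σ (Graph m) λ H → F m H × Σ (Fin m → Fin n) λ f →
    Injective _≡_ _≡_ f × (∀ i → InComp G S y (f i)) ×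
    (∀ i j → Adj H i j → Adj G (f i) (f j))

Legal : ∀ {n} → Graph n → Family → List (Fin n) → Fin n → Set
Legal G F S x = ∃ λ y → Dominates G x y × InComp G S y y × CompNotForbidden G F S y

data Player : Set where
  dominator staller : Player

-- GameVal G F fuel p S k : with chosen set S and p to move, the game
-- under optimal play lasts exactly k further moves (fuel bounds the depth;
-- fuel = n suffices since each legal move picks a new vertex).
GameVal : ∀ {n} → Graph n → Family → ℕ → Player → List (Fin n) → ℕ → Set
GameVal G F fuel p S zero = ¬ (∃ λ x → Legal G F S x)
GameVal G F zero p S (suc k) = ⊥
GameVal G F (suc f) dominator S (suc k) =
  ∃ λ x → Legal G F S x × GameVal G F f staller (x ∷ S) k ×
    (∀ y j → Legal G F S y → GameVal G F f staller (y ∷ S) j → k ≤ j)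
GameVal G F (suc f) staller S (suc k) =
  ∃ λ x → Legal G F S x × GameVal G F f dominator (x ∷ S) k ×
    (∀ y j → Legal G F S y → GameVal G F f dominator (y ∷ S) j → j ≤ k)

IsIotaG : ∀ {n} → Graph n → Family → ℕ → Set
IsIotaG {n} G F k = GameVal G F n dominator [] k

IsIotaG' : ∀ {n} → Graph n → Family → ℕ → Set
IsIotaG' {n} G F k = GameVal G F n staller [] k

{-# OPTIONS --safe #-}
-- Continuation principle: call a vertex live in a position S if its component of G − N[S] is not
-- F-forbidden. If every vertex live in T is live in S, then with the same player to move the game
-- from T ends no later than the game from S. Dominator answers in T with S's optimal move x when x is
-- legal in T. Otherwise x removes nothing live from T, so his own optimal move in T does at least
-- as well. Staller's optimal move in T is legal in S. After the first move x of either game, every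
-- vertex live in [x] is live in [], so each of ι_g and ι_g' is at most one more than the other.
-- Legality quantifies over an arbitrary family F and is undecidable, so optimal values only exist
-- classically: the argument runs in the double-negation monad and ends by stability of ≤ on ℕ.
module Submission where

open import Defs
open import Level using (0ℓ)
open import Data.Nat using (ℕ; zero; suc; _≤_; _<_; z≤n; s≤s; _≤?_)
open import Data.Nat.Properties
  using (≤-trans; <-≤-trans; ≤-refl; n≮0; ≤∧≢⇒<; m<1+n⇒m≤n; ≮⇒≥)
open import Data.Fin using (Fin) renaming (_≟_ to _≟ᶠ_)
open import Data.Fin.Subset using (Subset; ∣_∣; _∈_; _⊂_)
open import Data.Fin.Subset.Properties using (∣p∣≤n; p⊂q⇒∣p∣<∣q∣)
open import Data.Bool using (true) renaming (_≟_ to _≟ᵇ_)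
open import Data.Bool.Properties using (T-≡)
open import Data.Vec using (tabulate)
open import Data.Vec.Properties using (lookup∘tabulate; []=⇒lookup; lookup⇒[]=)
open import Data.List using (List; []; _∷_)
open import Data.List.Relation.Unary.Any using (here; there; any?)
open import Data.Empty using (⊥-elim)
open import Data.Product using (∃; _×_; _,_; proj₁; proj₂)
open import Effect.Monad using (RawMonad)
open import Function.Bundles using (Equivalence)
open import Relation.Nullary using (¬_; Dec; yes; no; ¬?)
open import Relation.Nullary.Decidable
  using (⌊_⌋; _⊎-dec_; toWitness; fromWitness; decidable-stable; ¬¬-excluded-middle)
open import Relation.Nullary.Negation using (DoubleNegation; ¬¬-Monad)
open import Relation.Unary using (_⊆_; ∁)
open import Relation.Binary.PropositionalEquality as ≡ using (refl; trans)

open RawMonad (¬¬-Monad {0ℓ})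

module _ (P : ℕ → Set) where

  ¬¬-least : ∀ j → P j → DoubleNegation (∃ λ k → P k × ∀ i → P i → k ≤ i)
  ¬¬-least j pj = below j (j , ≤-refl , pj)
    where
    below : ∀ b → (∃ λ j → j ≤ b × P j) → DoubleNegation (∃ λ k → P k × ∀ i → P i → k ≤ i)
    below zero (j , j≤0 , pj) = return (j , pj , λ _ _ → ≤-trans j≤0 z≤n)
    below (suc b) (j , j≤1+b , pj) = do
      no none≤b ← ¬¬-excluded-middle
        where yes some≤b → below b some≤b
      return (j , pj , λ i pi → ≤-trans j≤1+b (≮⇒≥ λ i<1+b → none≤b (i , m<1+n⇒m≤n i<1+b , pi)))

  ¬¬-greatest : ∀ b → (∀ i → P i → i ≤ b) → ∀ j → P j → DoubleNegation (∃ λ k → P k × ∀ i → P i → i ≤ k)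
  ¬¬-greatest zero ≤0 j pj = return (j , pj , λ i pi → ≤-trans (≤0 i pi) z≤n)
  ¬¬-greatest (suc b) ≤1+b j pj = do
    no ¬p1+b ← ¬¬-excluded-middle
      where yes p1+b → return (suc b , p1+b , ≤1+b)
    ¬¬-greatest b (λ i pi → m<1+n⇒m≤n (≤∧≢⇒< (≤1+b i pi) λ { refl → ¬p1+b pi })) j pj

module _ {n : ℕ} {G : Graph n} where

  inComp-outside : ∀ {S y z} → InComp G S y z → ¬ InClosedNbhd G S z
  inComp-outside (here y∉N[S]) = y∉N[S]
  inComp-outside (step _ _ w∉N[S]) = w∉N[S]

  inComp-trans : ∀ {S x y z} → InComp G S x y → InComp G S y z → InComp G S x z
  inComp-trans x~y (here _) = x~y
  inComp-trans x~y (step y~z z~w w∉N[S]) = step (inComp-trans x~y y~z) z~w w∉N[S]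

  inComp-sym : ∀ {S x y} → InComp G S x y → InComp G S y x
  inComp-sym (here x∉N[S]) = here x∉N[S]
  inComp-sym (step {z} {w} x~z zw w∉N[S]) =
    inComp-trans (step (here w∉N[S]) (trans (Graph.sym G w z) zw) (inComp-outside x~z)) (inComp-sym x~z)

  inComp-transfer : ∀ {A B r} → InComp G A r ⊆ ∁ (InClosedNbhd G B) → InComp G A r ⊆ InComp G B r
  inComp-transfer outside (here r∉N[A]) = here (outside (here r∉N[A]))
  inComp-transfer outside (step r~z zw w∉N[A]) =
    step (inComp-transfer outside r~z) zw (outside (step r~z zw w∉N[A]))

  module _ {F : Family} where

    notForbidden-transfer : ∀ {A B r} → InComp G A r ⊆ ∁ (InClosedNbhd G B) →
      CompNotForbidden G F A r → CompNotForbidden G F B r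
    notForbidden-transfer outside (m , H , H∈F , f , f-inj , f-in , f-hom) =
      m , H , H∈F , f , f-inj , (λ i → inComp-transfer outside (f-in i)) , f-hom

    notForbidden-reroot : ∀ {S r v} → CompNotForbidden G F S r → InComp G S r v → CompNotForbidden G F S v
    notForbidden-reroot (m , H , H∈F , f , f-inj , f-in , f-hom) r~v =
      m , H , H∈F , f , f-inj , (λ i → inComp-trans (inComp-sym r~v) (f-in i)) , f-hom

-- Legal G F S x unfolds to ∃ λ y → Dominates G x y × Live G F S y.
Live : ∀ {n} → Graph n → Family → List (Fin n) → Fin n → Set
Live G F S v = InComp G S v v × CompNotForbidden G F S v

module _ {n : ℕ} {G : Graph n} {F : Family} where

  live-transfer : ∀ {A B v} → InComp G A v ⊆ ∁ (InClosedNbhd G B) → Live G F A v → Live G F B v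
  live-transfer outside (v~v , notForbidden) =
    inComp-transfer outside v~v , notForbidden-transfer outside notForbidden

  live-spread : ∀ {S v w} → Live G F S v → InComp G S v w → Live G F S w
  live-spread (_ , notForbidden) v~w = here (inComp-outside v~w) , notForbidden-reroot notForbidden v~w

  live-outside : ∀ {S} → Live G F S ⊆ ∁ (InClosedNbhd G S)
  live-outside (v~v , _) = inComp-outside v~v

  legal-mono : ∀ {T S x} → Live G F T ⊆ Live G F S → Legal G F T x → Legal G F S x
  legal-mono T⊆S (y , x⇒y , live) = y , x⇒y , T⊆S live

  live-∷ : ∀ {S x} → Live G F (x ∷ S) ⊆ Live G F S
  live-∷ = live-transfer λ v~w w∈N[S] → inComp-outside v~w (there w∈N[S])

  live-∷-mono : ∀ {T S x} → Live G F T ⊆ Live G F S → Live G F (x ∷ T) ⊆ Live G F (x ∷ S)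
  live-∷-mono {T} {S} {x} T⊆S {v} live = live-transfer outside live
    where
    outside : InComp G (x ∷ T) v ⊆ ∁ (InClosedNbhd G (x ∷ S))
    outside v~w (here x⇒w) = inComp-outside v~w (here x⇒w)
    outside v~w (there w∈N[S]) = live-outside (T⊆S (live-∷ (live-spread live v~w))) w∈N[S]

  live-illegal : ∀ {T S x} → ¬ Legal G F T x → Live G F T ⊆ Live G F S → Live G F T ⊆ Live G F (x ∷ S)
  live-illegal {T} {S} {x} illegal T⊆S {v} live = live-transfer outside live
    where
    outside : InComp G T v ⊆ ∁ (InClosedNbhd G (x ∷ S))
    outside v~w (here x⇒w) = illegal (_ , x⇒w , live-spread live v~w)
    outside v~w (there w∈N[S]) = live-outside (T⊆S (live-spread live v~w)) w∈N[S]

inClosedNbhd? : ∀ {n} (G : Graph n) S v → Dec (InClosedNbhd G S v)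
inClosedNbhd? G S v = any? (λ s → (s ≟ᶠ v) ⊎-dec (Graph.E G s v ≟ᵇ true)) S

undominated : ∀ {n} → Graph n → List (Fin n) → Subset n
undominated G S = tabulate λ v → ⌊ ¬? (inClosedNbhd? G S v) ⌋

-- A legal move dominates a new vertex, so the number of undominated vertices bounds the rest of the game.
Fuel : ∀ {n} → Graph n → ℕ → List (Fin n) → Set
Fuel G f S = ∣ undominated G S ∣ ≤ f

module _ {n : ℕ} {G : Graph n} {F : Family} where

  ∈-undominated⁻ : ∀ {S v} → v ∈ undominated G S → ¬ InClosedNbhd G S v
  ∈-undominated⁻ {v = v} v∈ =
    toWitness (Equivalence.from T-≡ (trans (≡.sym (lookup∘tabulate _ v)) ([]=⇒lookup v∈)))

  ∈-undominated⁺ : ∀ {S v} → ¬ InClosedNbhd G S v → v ∈ undominated G S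
  ∈-undominated⁺ {v = v} v∉N[S] =
    lookup⇒[]= v _ (trans (lookup∘tabulate _ v) (Equivalence.to T-≡ (fromWitness v∉N[S])))

  legal⇒undominated-shrinks : ∀ {S x} → Legal G F S x → ∣ undominated G (x ∷ S) ∣ < ∣ undominated G S ∣
  legal⇒undominated-shrinks (y , x⇒y , live) = p⊂q⇒∣p∣<∣q∣
    ( (λ v∈ → ∈-undominated⁺ λ v∈N[S] → ∈-undominated⁻ v∈ (there v∈N[S]))
    , y , ∈-undominated⁺ (live-outside live) , λ y∈ → ∈-undominated⁻ y∈ (here x⇒y))

  fuel-move : ∀ {f S x} → Fuel G (suc f) S → Legal G F S x → Fuel G f (x ∷ S)
  fuel-move fuel legal = m<1+n⇒m≤n (<-≤-trans (legal⇒undominated-shrinks legal) fuel)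

  no-fuel⇒illegal : ∀ {S x} → Fuel G 0 S → ¬ Legal G F S x
  no-fuel⇒illegal fuel legal = n≮0 (<-≤-trans (legal⇒undominated-shrinks legal) fuel)

opponent : Player → Player
opponent dominator = staller
opponent staller = dominator

module _ {n : ℕ} {G : Graph n} {F : Family} where

  first-move : ∀ {f p S k} → GameVal G F (suc f) p S (suc k) →
    ∃ λ x → Legal G F S x × GameVal G F f (opponent p) (x ∷ S) k
  first-move {p = dominator} (x , legal , val , _) = x , legal , val
  first-move {p = staller} (x , legal , val , _) = x , legal , val

  gameVal-≤-fuel : ∀ {f p S k} → GameVal G F f p S k → k ≤ f
  gameVal-≤-fuel {k = zero} _ = z≤n
  gameVal-≤-fuel {zero} {k = suc _} ()
  gameVal-≤-fuel {suc _} {k = suc _} val = s≤s (gameVal-≤-fuel (proj₂ (proj₂ (first-move val))))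

  Reply : ℕ → Player → List (Fin n) → ℕ → Set
  Reply f p S j = ∃ λ y → Legal G F S y × GameVal G F f p (y ∷ S) j

  gameVal-exists : ∀ {f p S} → Fuel G f S → DoubleNegation (∃ (GameVal G F f p S))
  gameVal-exists {zero} fuel = return (0 , λ (_ , legal) → no-fuel⇒illegal fuel legal)
  gameVal-exists {suc f} {p} {S} fuel = do
      yes (x , legal) ← ¬¬-excluded-middle {A = ∃ (Legal G F S)}
        where no stuck → return (0 , stuck)
      (j , val) ← gameVal-exists (fuel-move fuel legal)
      optimal p (j , x , legal , val)
    where
    optimal : ∀ p → ∃ (Reply f (opponent p) S) → DoubleNegation (∃ (GameVal G F (suc f) p S))
    optimal dominator (j , reply) = do
      (k , (x , legal , val) , least) ← ¬¬-least (Reply f staller S) j reply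
      return (suc k , x , legal , val , λ y i legal′ val′ → least i (y , legal′ , val′))
    optimal staller (j , reply) = do
      (k , (x , legal , val) , greatest) ←
        ¬¬-greatest (Reply f dominator S) f (λ i (_ , _ , val′) → gameVal-≤-fuel val′) j reply
      return (suc k , x , legal , val , λ y i legal′ val′ → greatest i (y , legal′ , val′))

  continuation-principle : ∀ {f f′ p T S k k′} → Live G F T ⊆ Live G F S → Fuel G f T → Fuel G f′ S →
    GameVal G F f p T k → GameVal G F f′ p S k′ → k ≤ k′
  continuation-principle {k = zero} _ _ _ _ _ = z≤n
  continuation-principle {zero} {k = suc _} _ _ _ () _
  continuation-principle {suc _} {k = suc _} {zero} T⊆S _ _ valT stuckS =
    ⊥-elim (stuckS (_ , legal-mono T⊆S (proj₁ (proj₂ (first-move valT)))))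
  continuation-principle {suc _} {zero} {k = suc _} {suc _} _ _ _ _ ()
  continuation-principle {f = suc _} {f′ = suc _} {p = dominator} {T = T} {k = suc k} {k′ = suc k′}
    T⊆S fuelT fuelS (x₀ , legal₀ , val₀ , optimal₀) (x , legal , val , _) =
    s≤s (decidable-stable (k ≤? k′) do
      yes legalT ← ¬¬-excluded-middle {A = Legal G F T x}
        where no illegalT → return (continuation-principle (λ live → live-illegal illegalT T⊆S (live-∷ live))
                                      (fuel-move fuelT legal₀) (fuel-move fuelS legal) val₀ val)
      (j , valT) ← gameVal-exists (fuel-move fuelT legalT)
      return (≤-trans (optimal₀ x j legalT valT)
        (continuation-principle (live-∷-mono T⊆S) (fuel-move fuelT legalT) (fuel-move fuelS legal) valT val)))
  continuation-principle {f = suc _} {f′ = suc _} {p = staller} {S = S} {k = suc k} {k′ = suc k′}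
    T⊆S fuelT fuelS (x₀ , legal₀ , val₀ , _) (_ , _ , _ , optimal) =
    s≤s (decidable-stable (k ≤? k′) do
      (j , valS) ← gameVal-exists (fuel-move fuelS legalS)
      return (≤-trans
        (continuation-principle (live-∷-mono T⊆S) (fuel-move fuelT legal₀) (fuel-move fuelS legalS) val₀ valS)
        (optimal x₀ j legalS valS)))
    where
    legalS : Legal G F S x₀
    legalS = legal-mono T⊆S legal₀

  gameVal-opponent-≤ : ∀ {f p S k k′} → Fuel G f S →
    GameVal G F f p S k → GameVal G F f (opponent p) S k′ → k ≤ suc k′
  gameVal-opponent-≤ {k = zero} _ _ _ = z≤n
  gameVal-opponent-≤ {zero} {k = suc _} _ () _
  gameVal-opponent-≤ {suc _} {k = suc _} fuel val val′ with first-move val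
  ... | _ , legal , valx = s≤s (continuation-principle live-∷ (fuel-move fuel legal) fuel valx val′)

theorem2p3 : (n : ℕ) (G : Graph n) (F : Family) (k k' : ℕ) →
    IsIotaG G F k → IsIotaG' G F k' → k ≤ suc k' × k' ≤ suc k
theorem2p3 n G F k k' ιg ιg' = gameVal-opponent-≤ fuel ιg ιg' , gameVal-opponent-≤ fuel ιg' ιg
  where
  fuel : Fuel G n []
  fuel = ∣p∣≤n (undominated G [])
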